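{- Every acceptor that is an automata cascade whose components are automata with a flip-flop semiautomaton composed with an input function admits an equivalent Past LTL formula of size at most exponential (in the size of the cascade); i.e. a formula $\varphi$ that accepts exactly the strings the acceptor recognises.
   Context: Past LTL formulas are built from propositional variables and $\top,\bot$ using $\neg,\land,\lor$, the before operator $\ominus$ and the since operator $\mathsf{S}$; over interpretations $I=I_1,\dots,I_\ell$ (sets of variables): $(I,t)\models a$ iff $a\in I_t$; Boolean connectives as usual; $(I,t)\models\ominus\alpha$ iff $(I,t-1)\models\alpha$; $(I,t)\models\alpha\,\mathsf{S}\,\beta$ iff there is $j\in[1,t]$ with $(I,j)\models\beta$ and $(I,k)\models\alpha$ for all $k\in[j+1,t]$. A formula over ordered variables $a_1,\dots,a_m$ accepts a string $\sigma_1\dots\sigma_\ell$ over $\{0,1\}^m$ (letters read as assignments) iff $(I,\ell)\models\varphi$. A semiautomaton is $\langle\Sigma,Q,\delta\rangle$; composition of an input function $\phi:\Sigma\to\Pi$ with $\langle\Pi,Q,\delta\rangle$ is $\langle\Sigma,Q,\delta_\phi\rangle$, $\delta_\phi(q,\sigma)=\delta(q,\phi(\sigma))$. A flip-flop semiautomaton is (isomorphic to) the canonical flip-flop: inputs $\{set,reset,read\}$, states $\{high,low\}$, $\delta(q,read)=q$, $\delta(q,set)=high$, $\delta(q,reset)=low$. An automaton is $\langle\Sigma,Q,\delta,q_{\mathrm{init}},\Gamma,\theta\rangle$ with $\theta:Q\times\Sigma\to\Gamma$; on $\sigma_1\dots\sigma_\ell$ its states are $q_0=q_{\mathrm{init}}$,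 $q_i=\delta(q_{i-1},\sigma_i)$ and upon reading $\sigma_i$ it outputs $\theta(q_{i-1},\sigma_i)$. An acceptor is an automaton with $\Gamma=\{0,1\}$; it recognises the strings on which its last output is $1$. An automata cascade $A_1\ltimes\dots\ltimes A_d$ of automata $A_i=\langle\Sigma_i,Q_i,\delta_i,q^{\mathrm{init}}_i,\Gamma_i,\theta_i\rangle$ with $\Sigma_i=\Sigma\times\Gamma_1\times\dots\times\Gamma_{i-1}$ is the automaton with input alphabet $\Sigma$, states $Q_1\times\dots\times Q_d$, initial state $\langle q^{\mathrm{init}}_1,\dots,q^{\mathrm{init}}_d\rangle$, transition $\delta(\langle q_1,\dots,q_d\rangle,\sigma)=\langle\delta_1(q_1,\sigma_1),\dots,\delta_d(q_d,\sigma_d)\rangle$ with $\sigma_i=\langle\sigma,\theta_1(q_1,\sigma_1),\dots,\theta_{i-1}(q_{i-1},\sigma_{i-1})\rangle$, and output $\theta_d(q_d,\sigma_d)$. Input alphabets are of the form $\{0,1\}^m$. -}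

module Defs where

open import Data.Nat using (ℕ; zero; suc; _+_; _*_; _^_; _≤_; _<_)
open import Data.Fin using (Fin)
open import Data.Bool using (Bool; true; false)
open import Data.Vec using (Vec; []; _∷_; _++_; lookup)
open import Data.List using (List; []; _∷_)
open import Data.Maybe using (Maybe; just; nothing)
open import Data.Product using (_×_; _,_; ∃; proj₁; proj₂)
open import Data.Sum using (_⊎_)
open import Data.Unit using (⊤; tt)
open import Data.Empty using (⊥)
open import Relation.Nullary using (¬_)
open import Relation.Binary.PropositionalEquality using (_≡_)

data PLTL (m : ℕ) : Set where
  var  : Fin m → PLTL m
  ⊤ᶠ   : PLTL m
  ⊥ᶠ   : PLTL m
  ¬ᶠ_  : PLTL m → PLTL m
  _∧ᶠ_ : PLTL m → PLTL m → PLTL m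
  _∨ᶠ_ : PLTL m → PLTL m → PLTL m
  ⊖_   : PLTL m → PLTL m
  _S_  : PLTL m → PLTL m → PLTL m

size : ∀ {m} → PLTL m → ℕ
size (var _)   = 1
size ⊤ᶠ        = 1
size ⊥ᶠ        = 1
size (¬ᶠ α)    = suc (size α)
size (α ∧ᶠ β)  = suc (size α + size β)
size (α ∨ᶠ β)  = suc (size α + size β)
size (⊖ α)     = suc (size α)
size (α S β)   = suc (size α + size β)

-- the letter at (1-based) position t of a string, if any
letterAt : ∀ {A : Set} → List A → ℕ → Maybe A
letterAt w        zero          = nothing
letterAt []       (suc t)       = nothing
letterAt (x ∷ w)  (suc zero)    = just x
letterAt (x ∷ w)  (suc (suc t)) = letterAt w (suc t)

-- (I , t) ⊨ φ, where the string w = σ_1 … σ_ℓ is read as the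
-- interpretation I with I_t = { a_i | σ_t[i] = 1 }; positions are 1 … ℓ.
_,_⊨_ : ∀ {m} → List (Vec Bool m) → ℕ → PLTL m → Set
w , t ⊨ var i    = ∃ λ σ → letterAt w t ≡ just σ × lookup σ i ≡ true
w , t ⊨ ⊤ᶠ       = ⊤
w , t ⊨ ⊥ᶠ       = ⊥
w , t ⊨ (¬ᶠ α)   = ¬ (w , t ⊨ α)
w , t ⊨ (α ∧ᶠ β) = (w , t ⊨ α) × (w , t ⊨ β)
w , t ⊨ (α ∨ᶠ β) = (w , t ⊨ α) ⊎ (w , t ⊨ β)
w , zero          ⊨ (⊖ α) = ⊥
w , suc zero      ⊨ (⊖ α) = ⊥      -- there is no position 0
w , suc (suc t)   ⊨ (⊖ α) = w , suc t ⊨ α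
w , t ⊨ (α S β)  =
  ∃ λ j → 1 ≤ j × j ≤ t × (w , j ⊨ β) ×
          (∀ k → j < k → k ≤ t → w , k ⊨ α)

length : ∀ {A : Set} → List A → ℕ
length []      = 0
length (_ ∷ w) = suc (length w)

Accepts : ∀ {m} → PLTL m → List (Vec Bool m) → Set
Accepts φ w = w , length w ⊨ φ

data FFInput : Set where
  set reset read : FFInput

data FFState : Set where
  high low : FFState

ffδ : FFState → FFInput → FFState
ffδ q read  = q
ffδ q set   = high
ffδ q reset = low

record FFAutomaton (n k : ℕ) : Set where
  field
    inputFn : Vec Bool n → FFInput
    qinit   : FFState
    output  : FFState → Vec Bool n → Vec Bool k
open FFAutomaton public

-- The index K is the total width k_1 + … + k_j of their outputs, so the
-- next component reads  σ ++ γ_1 ++ … ++ γ_j  ∈ {0,1}^(m + K).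
data Chain (m : ℕ) : ℕ → Set where
  []  : Chain m 0
  _▷_ : ∀ {K k} → Chain m K → FFAutomaton (m + K) k → Chain m (K + k)

ChainState : ∀ {m K} → Chain m K → Set
ChainState []      = ⊤
ChainState (c ▷ A) = ChainState c × FFState

chainInit : ∀ {m K} (c : Chain m K) → ChainState c
chainInit []      = tt
chainInit (c ▷ A) = chainInit c , qinit A

chainStep : ∀ {m K} (c : Chain m K) → ChainState c → Vec Bool m
          → Vec Bool K × ChainState c
chainStep []      tt      σ = [] , tt
chainStep (c ▷ A) (s , q) σ =
  let r = chainStep c s σ
      x = σ ++ proj₁ r
  in (proj₁ r ++ output A q x) , (proj₂ r , ffδ q (inputFn A x))

record FFCascadeAcceptor (m : ℕ) : Set where
  constructor cascade
  field
    {K}    : ℕ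
    front  : Chain m K
    last   : FFAutomaton (m + K) 1
open FFCascadeAcceptor public

AccState : ∀ {m} → FFCascadeAcceptor m → Set
AccState A = ChainState (front A) × FFState

-- output of the cascade upon reading the last letter (nothing on ε)
lastOutput : ∀ {m} (A : FFCascadeAcceptor m) → AccState A
           → List (Vec Bool m) → Maybe Bool
lastOutput A s       []      = nothing
lastOutput A (s , q) (σ ∷ w) =
  let r = chainStep (front A) s σ
      x = σ ++ proj₁ r
      s' = proj₂ r , ffδ q (inputFn (last A) x)
  in helper (lookup (output (last A) q x) Data.Fin.zero) (lastOutput A s' w)
  where
    helper : Bool → Maybe Bool → Maybe Bool
    helper b nothing  = just b
    helper b (just c) = just c

Recognises : ∀ {m} → FFCascadeAcceptor m → List (Vec Bool m) → Set
Recognises A w = lastOutput A (chainInit (front A) , qinit (last A)) w ≡ just true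

-- Size of the cascade: sum over the components of the sizes of their
-- transition and output tables, |Q|·|Σ_i|·(1 + k_i) = 2 · 2^(n_i) · (1 + k_i).

ffSize : ∀ {n k} → FFAutomaton n k → ℕ
ffSize {n} {k} A = 2 * (2 ^ n) * suc k

chainSize : ∀ {m K} → Chain m K → ℕ
chainSize []      = 0
chainSize (c ▷ A) = chainSize c + ffSize A

cascadeSize : ∀ {m} → FFCascadeAcceptor m → ℕ
cascadeSize A = chainSize (front A) + ffSize (last A)

{-# OPTIONS --safe #-}
-- A flip-flop is high after position t iff the last input up to t that is not read was set,
-- or there was none and its initial state is high; with set, reset and read written as
-- formulas over the letter the component reads, this is
-- ((¬ reset) S set) ∨ (init ∧ ¬ (⊤ S ¬ read)), and ⊖ shifts it to the state in which
-- position t is read. A component reads the input letter together with the outputs of the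
-- earlier components, and each of its output bits is a Boolean function of its state and that
-- letter. Writing a Boolean function of n formulas as its Shannon expansion adds 3n to the
-- nesting depth, so a component reading n bits adds O(n) ≤ O(2^n) to the depth; the depth is
-- thus linear in the size of the cascade, and a formula of depth d has fewer than 2^d nodes.
module Submission where

open import Defs
open import Data.Nat using (ℕ; zero; suc; _+_; _*_; _^_; _⊔_; _≤_; _<_; pred; z≤n; s≤s)
open import Data.Nat.Properties
open import Data.Nat.Tactic.RingSolver using (solve-∀)
open import Data.Bool using (Bool; true; false; not; _∧_; _∨_; T)
open import Data.Bool.Properties using (∧-identityʳ; ∧-zeroʳ; ∨-identityʳ; T-≡; T-∧; T-∨)
open import Data.Fin using (Fin; splitAt; _↑ʳ_) renaming (zero to fzero; suc to fsuc)
open import Data.Fin.Properties using (splitAt⁻¹-↑ˡ; splitAt⁻¹-↑ʳ)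
open import Data.Vec using (Vec; []; _∷_; _++_; lookup; tabulate; tail; replicate)
open import Data.Vec.Properties using (lookup∘tabulate; lookup-++ˡ; lookup-++ʳ)
open import Data.Vec.Relation.Unary.All as All using (All; []; _∷_)
open import Data.Vec.Relation.Unary.All.Properties using (++⁺; tabulate⁺; lookup⁺)
open import Data.List using (List; []; _∷_; drop)
open import Data.Maybe using (Maybe; just; fromMaybe)
open import Data.Maybe.Properties using (just-injective)
open import Data.Product using (Σ; _×_; _,_; proj₁; proj₂)
open import Data.Product.Function.NonDependent.Propositional using (_×-⇔_)
open import Data.Sum using (_⊎_; inj₁; inj₂)
open import Data.Sum.Function.Propositional using (_⊎-⇔_)
open import Data.Empty using (⊥-elim)
open import Function using (_∘_; id)
open import Function.Bundles using (_⇔_; mk⇔; Equivalence)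
open import Function.Construct.Composition using (_⇔-∘_)
open import Function.Construct.Symmetry using (⇔-sym)
open import Function.Related.TypeIsomorphisms using (¬-cong-⇔)
open import Relation.Nullary using (¬_)
open import Relation.Binary.PropositionalEquality using (_≡_; refl; sym; trans; cong; subst)

-- Boolean signals

since : (ℕ → Bool) → (ℕ → Bool) → ℕ → Bool
since a b zero    = false
since a b (suc t) = b (suc t) ∨ (a (suc t) ∧ since a b t)

previous : (ℕ → Bool) → ℕ → Bool
previous a zero          = false
previous a (suc zero)    = false
previous a (suc (suc t)) = a (suc t)

-- Runs of a flip-flop

isHigh : FFState → Bool
isHigh high = true
isHigh low  = false

fromBool : Bool → FFState
fromBool true  = high
fromBool false = low

fromBool-isHigh : ∀ q → fromBool (isHigh q) ≡ q
fromBool-isHigh high = refl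
fromBool-isHigh low  = refl

isSet isReset isRead : FFInput → Bool
isSet set = true
isSet _   = false
isReset reset = true
isReset _     = false
isRead read = true
isRead _    = false

run : FFState → (ℕ → FFInput) → ℕ → FFState
run q u zero    = q
run q u (suc t) = ffδ (run q u t) (u (suc t))

highAfter : FFState → (ℕ → FFInput) → ℕ → Bool
highAfter q u t =
  since (λ s → not (isReset (u s))) (λ s → isSet (u s)) t ∨
  (isHigh q ∧ not (since (λ _ → true) (λ s → not (isRead (u s))) t))

highBefore : FFState → (ℕ → FFInput) → ℕ → Bool
highBefore q u t = previous (highAfter q u) t ∨ (not (previous (λ _ → true) t) ∧ isHigh q)

isHigh-run : ∀ q u t → isHigh (run q u t) ≡ highAfter q u t
isHigh-run q u zero = sym (∧-identityʳ (isHigh q))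
isHigh-run q u (suc t) with u (suc t)
... | set   = refl
... | reset = sym (∧-zeroʳ (isHigh q))
... | read  = isHigh-run q u t

highBefore-run : ∀ q u t → highBefore q u (suc t) ≡ isHigh (run q u t)
highBefore-run q u zero    = refl
highBefore-run q u (suc t) = trans (∨-identityʳ _) (sym (isHigh-run q u (suc t)))

-- Formulas

module _ {m : ℕ} where

  const : Bool → PLTL m
  const true  = ⊤ᶠ
  const false = ⊥ᶠ

  shannon : ∀ {n} → (Vec Bool n → Bool) → Vec (PLTL m) n → PLTL m
  shannon g []      = const (g [])
  shannon g (φ ∷ F) =
    (φ ∧ᶠ shannon (g ∘ (true ∷_)) F) ∨ᶠ ((¬ᶠ φ) ∧ᶠ shannon (g ∘ (false ∷_)) F)

outputBit : ∀ {n k} → FFAutomaton n k → Fin k → Vec Bool (suc n) → Bool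
outputBit A j (h ∷ v) = lookup (output A (fromBool h) v) j

module FlipFlop {m n k} (A : FFAutomaton n k) (X : Vec (PLTL m) n) where

  inputIs : (FFInput → Bool) → PLTL m
  inputIs p = shannon (p ∘ inputFn A) X

  highAfterᶠ : PLTL m
  highAfterᶠ =
    ((¬ᶠ inputIs isReset) S inputIs isSet) ∨ᶠ
    (const (isHigh (qinit A)) ∧ᶠ (¬ᶠ (⊤ᶠ S (¬ᶠ inputIs isRead))))

  highBeforeᶠ : PLTL m
  highBeforeᶠ = (⊖ highAfterᶠ) ∨ᶠ ((¬ᶠ (⊖ ⊤ᶠ)) ∧ᶠ const (isHigh (qinit A)))

  outputᶠ : Vec (PLTL m) k
  outputᶠ = tabulate λ j → shannon (outputBit A j) (highBeforeᶠ ∷ X)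

module _ {m : ℕ} where

  outputsᶠ : ∀ {K} → Chain m K → Vec (PLTL m) K
  inputsᶠ  : ∀ {K} → Chain m K → Vec (PLTL m) (m + K)

  outputsᶠ []      = []
  outputsᶠ (c ▷ A) = outputsᶠ c ++ FlipFlop.outputᶠ A (inputsᶠ c)

  inputsᶠ c = tabulate var ++ outputsᶠ c

toChain : ∀ {m} (A : FFCascadeAcceptor m) → Chain m (K A + 1)
toChain A = front A ▷ last A

cascadeFormula : ∀ {m} → FFCascadeAcceptor m → PLTL m
cascadeFormula A = lookup (outputsᶠ (toChain A)) (K A ↑ʳ fzero)

-- Semantics along a word

letterAt-just : ∀ {A : Set} (w : List A) t d → suc t ≤ length w →
                letterAt w (suc t) ≡ just (fromMaybe d (letterAt w (suc t)))
letterAt-just (x ∷ w) zero    d _       = refl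
letterAt-just (x ∷ w) (suc t) d (s≤s h) = letterAt-just w t d h

letterAt-drop : ∀ {A : Set} (w : List A) t {x u} → drop t w ≡ x ∷ u → letterAt w (suc t) ≡ just x
letterAt-drop (y ∷ w) zero    refl = refl
letterAt-drop (y ∷ w) (suc t) e    = letterAt-drop w t e

drop-suc : ∀ {A : Set} (w : List A) t {x u} → drop t w ≡ x ∷ u → drop (suc t) w ≡ u
drop-suc (y ∷ w) zero    refl = refl
drop-suc (y ∷ w) (suc t) e    = drop-suc w t e

length-drop-last : ∀ {A : Set} (w : List A) t {x} → drop t w ≡ x ∷ [] → length w ≡ suc t
length-drop-last (y ∷ w) zero    refl = refl
length-drop-last (y ∷ w) (suc t) e    = cong suc (length-drop-last w t e)

¬T⇔T-not : ∀ {b} → (¬ T b) ⇔ T (not b)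
¬T⇔T-not {true}  = mk⇔ (λ ¬t → ¬t _) (λ ())
¬T⇔T-not {false} = mk⇔ _ (λ _ ())

shannon-step : ∀ {n} (g : Vec Bool (suc n) → Bool) v →
  (lookup v fzero ∧ g (true ∷ tail v)) ∨ (not (lookup v fzero) ∧ g (false ∷ tail v)) ≡ g v
shannon-step g (true  ∷ v) = ∨-identityʳ _
shannon-step g (false ∷ v) = refl

module Semantics {m : ℕ} (W : List (Vec Bool m)) where

  record Denotes (φ : PLTL m) (a : ℕ → Bool) : Set where
    constructor denotes
    field at : ∀ t → suc t ≤ length W → (W , suc t ⊨ φ) ⇔ T (a (suc t))
  open Denotes

  record Denotesᵛ {n} (F : Vec (PLTL m) n) (x : ℕ → Vec Bool n) : Set where
    constructor denotesᵛ
    field component : ∀ i → Denotes (lookup F i) (λ t → lookup (x t) i)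
  open Denotesᵛ

  Denotes-cong : ∀ {φ ψ a b} → φ ≡ ψ → (∀ t → a (suc t) ≡ b (suc t)) → Denotes φ a → Denotes ψ b
  Denotes-cong {φ} refl a≗b d = denotes λ t h → subst (λ c → (W , suc t ⊨ φ) ⇔ T c) (a≗b t) (at d t h)

  Denotesᵛ-cong : ∀ {n} {F : Vec (PLTL m) n} {x y} → (∀ t → x (suc t) ≡ y (suc t)) →
                  Denotesᵛ F x → Denotesᵛ F y
  Denotesᵛ-cong x≗y d =
    denotesᵛ λ i → Denotes-cong refl (λ t → cong (λ v → lookup v i) (x≗y t)) (component d i)

  Denotes-⊤ : Denotes ⊤ᶠ (λ _ → true)
  Denotes-⊤ = denotes λ _ _ → mk⇔ id id

  Denotes-const : ∀ b → Denotes (const b) (λ _ → b)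
  Denotes-const true  = Denotes-⊤
  Denotes-const false = denotes λ _ _ → mk⇔ id id

  Denotes-¬ : ∀ {α a} → Denotes α a → Denotes (¬ᶠ α) (λ t → not (a t))
  Denotes-¬ d = denotes λ t h → ¬T⇔T-not ⇔-∘ ¬-cong-⇔ (at d t h)

  Denotes-∧ : ∀ {α β a b} → Denotes α a → Denotes β b → Denotes (α ∧ᶠ β) (λ t → a t ∧ b t)
  Denotes-∧ d e = denotes λ t h → ⇔-sym T-∧ ⇔-∘ (at d t h ×-⇔ at e t h)

  Denotes-∨ : ∀ {α β a b} → Denotes α a → Denotes β b → Denotes (α ∨ᶠ β) (λ t → a t ∨ b t)
  Denotes-∨ d e = denotes λ t h → ⇔-sym T-∨ ⇔-∘ (at d t h ⊎-⇔ at e t h)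

  Denotes-⊖ : ∀ {α a} → Denotes α a → Denotes (⊖ α) (previous a)
  Denotes-⊖ d = denotes λ where
    zero    _ → mk⇔ id id
    (suc t) h → at d t (<⇒≤ h)

  S-unfold : ∀ {α β} t →
    (W , suc t ⊨ (α S β)) ⇔ ((W , suc t ⊨ β) ⊎ ((W , suc t ⊨ α) × (W , t ⊨ (α S β))))
  S-unfold {α} {β} t = mk⇔ to from
    where
      to : W , suc t ⊨ (α S β) → (W , suc t ⊨ β) ⊎ ((W , suc t ⊨ α) × (W , t ⊨ (α S β)))
      to (j , 1≤j , j≤1+t , βⱼ , α-after) with m≤n⇒m<n∨m≡n j≤1+t
      ... | inj₂ refl      = inj₁ βⱼ
      ... | inj₁ (s≤s j≤t) = inj₂ (α-after (suc t) (s≤s j≤t) ≤-refl ,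
                                   (j , 1≤j , j≤t , βⱼ , λ k j<k k≤t → α-after k j<k (m≤n⇒m≤1+n k≤t)))

      from : (W , suc t ⊨ β) ⊎ ((W , suc t ⊨ α) × (W , t ⊨ (α S β))) → W , suc t ⊨ (α S β)
      from (inj₁ β₁₊ₜ) = suc t , s≤s z≤n , ≤-refl , β₁₊ₜ , λ k t<k k≤t → ⊥-elim (<⇒≱ t<k k≤t)
      from (inj₂ (α₁₊ₜ , j , 1≤j , j≤t , βⱼ , α-after)) = j , 1≤j , m≤n⇒m≤1+n j≤t , βⱼ , α-after′
        where
          α-after′ : ∀ k → j < k → k ≤ suc t → W , k ⊨ α
          α-after′ k j<k k≤1+t with m≤n⇒m<n∨m≡n k≤1+t
          ... | inj₁ (s≤s k≤t) = α-after k j<k k≤t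
          ... | inj₂ refl      = α₁₊ₜ

  Denotes-S : ∀ {α β a b} → Denotes α a → Denotes β b → Denotes (α S β) (since a b)
  Denotes-S {α} {β} {a} {b} dα dβ = denotes λ t → go (suc t)
    where
      go : ∀ t → t ≤ length W → (W , t ⊨ (α S β)) ⇔ T (since a b t)
      go zero    _ = mk⇔ (λ { (_ , 1≤j , j≤0 , _) → ⊥-elim (<⇒≱ 1≤j j≤0) }) (λ ())
      go (suc t) h =
        ⇔-sym T-∨ ⇔-∘ ((at dβ t h ⊎-⇔ (⇔-sym T-∧ ⇔-∘ (at dα t h ×-⇔ go t (<⇒≤ h))))
                       ⇔-∘ S-unfold {α} {β} t)

  letter : ℕ → Vec Bool m
  letter t = fromMaybe (replicate m false) (letterAt W t)

  Denotes-var : ∀ i → Denotes (var i) (λ t → lookup (letter t) i)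
  Denotes-var i = denotes λ t h → var-at t (letterAt-just W t (replicate m false) h)
    where
      var-at : ∀ t → letterAt W (suc t) ≡ just (letter (suc t)) →
               (W , suc t ⊨ var i) ⇔ T (lookup (letter (suc t)) i)
      var-at t letter-ok = mk⇔
        (λ (σ , e , σᵢ) → Equivalence.from T-≡
          (subst (λ τ → lookup τ i ≡ true) (just-injective (trans (sym e) letter-ok)) σᵢ))
        (λ l → letter (suc t) , letter-ok , Equivalence.to T-≡ l)

  Denotesᵛ-∷ : ∀ {n φ a} {F : Vec (PLTL m) n} {x} → Denotes φ a → Denotesᵛ F x →
               Denotesᵛ (φ ∷ F) (λ t → a t ∷ x t)
  Denotesᵛ-∷ d dF = denotesᵛ λ where
    fzero    → d
    (fsuc i) → component dF i

  Denotesᵛ-tail : ∀ {n φ} {F : Vec (PLTL m) n} {x} → Denotesᵛ (φ ∷ F) x → Denotesᵛ F (tail ∘ x)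
  Denotesᵛ-tail {x = x} d =
    denotesᵛ λ i → Denotes-cong refl (λ t → lookup-suc (x (suc t)) i) (component d (fsuc i))
    where
      lookup-suc : ∀ {n} (v : Vec Bool (suc n)) j → lookup v (fsuc j) ≡ lookup (tail v) j
      lookup-suc (_ ∷ v) j = refl

  Denotesᵛ-++ : ∀ {p q} {F : Vec (PLTL m) p} {G : Vec (PLTL m) q} {x y} →
                Denotesᵛ F x → Denotesᵛ G y → Denotesᵛ (F ++ G) (λ t → x t ++ y t)
  Denotesᵛ-++ {p} {q} {F} {G} {x} {y} dF dG = denotesᵛ component-++
    where
      Component : Fin (p + q) → Set
      Component i = Denotes (lookup (F ++ G) i) (λ t → lookup (x t ++ y t) i)

      component-++ : ∀ i → Component i
      component-++ i with splitAt p i in eq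
      ... | inj₁ j = subst Component (splitAt⁻¹-↑ˡ eq) (Denotes-cong (sym (lookup-++ˡ F G j))
                       (λ t → sym (lookup-++ˡ (x (suc t)) (y (suc t)) j)) (component dF j))
      ... | inj₂ j = subst Component (splitAt⁻¹-↑ʳ eq) (Denotes-cong (sym (lookup-++ʳ F G j))
                       (λ t → sym (lookup-++ʳ (x (suc t)) (y (suc t)) j)) (component dG j))

  Denotesᵛ-tabulate : ∀ {n} {f : Fin n → PLTL m} {x} →
                      (∀ i → Denotes (f i) (λ t → lookup (x t) i)) → Denotesᵛ (tabulate f) x
  Denotesᵛ-tabulate {f = f} d =
    denotesᵛ λ i → Denotes-cong (sym (lookup∘tabulate f i)) (λ _ → refl) (d i)

  Denotes-shannon : ∀ {n} (g : Vec Bool n → Bool) {F : Vec (PLTL m) n} {x} →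
                    Denotesᵛ F x → Denotes (shannon g F) (λ t → g (x t))
  Denotes-shannon g {[]} {x} d =
    Denotes-cong refl (λ t → cong g (empty (x (suc t)))) (Denotes-const (g []))
    where
      empty : (v : Vec Bool 0) → [] ≡ v
      empty [] = refl
  Denotes-shannon g {φ ∷ F} {x} d = Denotes-cong refl (λ t → shannon-step g (x (suc t)))
    (Denotes-∨ (Denotes-∧ (component d fzero) (Denotes-shannon (g ∘ (true ∷_)) d-tail))
               (Denotes-∧ (Denotes-¬ (component d fzero)) (Denotes-shannon (g ∘ (false ∷_)) d-tail)))
    where
      d-tail : Denotesᵛ F (tail ∘ x)
      d-tail = Denotesᵛ-tail d

  module _ {n k} (A : FFAutomaton n k) {X : Vec (PLTL m) n} {x : ℕ → Vec Bool n}
           (dX : Denotesᵛ X x) where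
    open FlipFlop A X

    private
      u : ℕ → FFInput
      u t = inputFn A (x t)

    Denotes-highAfter : Denotes highAfterᶠ (highAfter (qinit A) u)
    Denotes-highAfter =
      Denotes-∨ (Denotes-S (Denotes-¬ (Denotes-shannon _ dX)) (Denotes-shannon _ dX))
                (Denotes-∧ (Denotes-const _)
                           (Denotes-¬ (Denotes-S Denotes-⊤ (Denotes-¬ (Denotes-shannon _ dX)))))

    Denotes-highBefore : Denotes highBeforeᶠ (λ t → isHigh (run (qinit A) u (pred t)))
    Denotes-highBefore = Denotes-cong refl (highBefore-run (qinit A) u)
      (Denotes-∨ (Denotes-⊖ Denotes-highAfter)
                 (Denotes-∧ (Denotes-¬ (Denotes-⊖ Denotes-⊤)) (Denotes-const _)))

    Denotesᵛ-output : Denotesᵛ outputᶠ (λ t → output A (run (qinit A) u (pred t)) (x t))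
    Denotesᵛ-output = Denotesᵛ-tabulate λ j →
      Denotes-cong refl (λ t → cong (λ q → lookup (output A q (x (suc t))) j) (fromBool-isHigh _))
        (Denotes-shannon (outputBit A j) (Denotesᵛ-∷ Denotes-highBefore dX))

  states : ∀ {K} (c : Chain m K) → ℕ → ChainState c
  states c zero    = chainInit c
  states c (suc t) = proj₂ (chainStep c (states c t) (letter (suc t)))

  outputs : ∀ {K} (c : Chain m K) → ℕ → Vec Bool K
  outputs c t = proj₁ (chainStep c (states c (pred t)) (letter t))

  inputs : ∀ {K} (c : Chain m K) → ℕ → Vec Bool (m + K)
  inputs c t = letter t ++ outputs c t

  states-▷ : ∀ {K k} (c : Chain m K) (A : FFAutomaton (m + K) k) t →
             states (c ▷ A) t ≡ (states c t , run (qinit A) (inputFn A ∘ inputs c) t)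
  states-▷ c A zero = refl
  states-▷ c A (suc t) rewrite states-▷ c A t = refl

  Denotesᵛ-outputs : ∀ {K} (c : Chain m K) → Denotesᵛ (outputsᶠ c) (outputs c)
  Denotesᵛ-inputs : ∀ {K} (c : Chain m K) → Denotesᵛ (inputsᶠ c) (inputs c)

  Denotesᵛ-outputs [] = denotesᵛ λ ()
  Denotesᵛ-outputs (c ▷ A) =
    Denotesᵛ-cong (λ t → cong (λ s → proj₁ (chainStep (c ▷ A) s _)) (sym (states-▷ c A t)))
      (Denotesᵛ-++ (Denotesᵛ-outputs c) (Denotesᵛ-output A (Denotesᵛ-inputs c)))

  Denotesᵛ-inputs c = Denotesᵛ-++ (Denotesᵛ-tabulate Denotes-var) (Denotesᵛ-outputs c)

  letter-drop : ∀ t {σ u} → drop t W ≡ σ ∷ u → letter (suc t) ≡ σ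
  letter-drop t e = cong (fromMaybe (replicate m false)) (letterAt-drop W t e)

  module _ (A : FFCascadeAcceptor m) where

    acceptBit : ℕ → Bool
    acceptBit t = lookup (outputs (toChain A) t) (K A ↑ʳ fzero)

    lastOutput-states : ∀ t {σ u} → drop t W ≡ σ ∷ u →
                        lastOutput A (states (toChain A) t) (σ ∷ u) ≡ just (acceptBit (length W))
    lastOutput-states t {u = []} e
      rewrite sym (letter-drop t e) | length-drop-last W t e =
        cong just (sym (lookup-++ʳ (proj₁ r) (output (last A) (proj₂ s) (σ ++ proj₁ r)) fzero))
      where
        s = states (toChain A) t
        σ = letter (suc t)
        r = chainStep (front A) (proj₁ s) σ
    lastOutput-states t {u = σ′ ∷ u} e
      rewrite sym (letter-drop t e) | lastOutput-states (suc t) (drop-suc W t e) = refl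

just-true⇔T : ∀ {mb : Maybe Bool} {b} → mb ≡ just b → (mb ≡ just true) ⇔ T b
just-true⇔T refl = ⇔-sym T-≡ ⇔-∘ mk⇔ just-injective (cong just)

cascadeFormula-correct : ∀ {m} (A : FFCascadeAcceptor m) σ w →
                         Accepts (cascadeFormula A) (σ ∷ w) ⇔ Recognises A (σ ∷ w)
cascadeFormula-correct A σ w =
  ⇔-sym (just-true⇔T (lastOutput-states A 0 refl)) ⇔-∘
  Denotes.at (Denotesᵛ.component (Denotesᵛ-outputs (toChain A)) (K A ↑ʳ fzero)) (length w) ≤-refl
  where open Semantics (σ ∷ w)

-- Heights and sizes

binary-bound : ∀ h {a b} → a < 2 ^ h → b < 2 ^ h → suc (a + b) < 2 ^ suc h
binary-bound h {a} {b} a< b< = begin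
  suc (suc (a + b))    ≡⟨ cong suc (+-suc a b) ⟨
  suc a + suc b        ≤⟨ +-mono-≤ a< b< ⟩
  2 ^ h + 2 ^ h        ≡⟨ cong (2 ^ h +_) (+-identityʳ (2 ^ h)) ⟨
  2 ^ suc h            ∎
  where open ≤-Reasoning

unary-bound : ∀ h {a} → a < 2 ^ h → suc a < 2 ^ suc h
unary-bound h {a} a< = ≤-trans (s≤s (s≤s (m≤m+n a a))) (binary-bound h a< a<)

leaf-bound : ∀ h → 1 < 2 ^ suc h
leaf-bound h = binary-bound h (m^n>0 2 h) (m^n>0 2 h)

module _ {m : ℕ} where

  height : PLTL m → ℕ
  height (var _)  = 1
  height ⊤ᶠ       = 1
  height ⊥ᶠ       = 1
  height (¬ᶠ α)   = suc (height α)
  height (α ∧ᶠ β) = suc (height α ⊔ height β)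
  height (α ∨ᶠ β) = suc (height α ⊔ height β)
  height (⊖ α)    = suc (height α)
  height (α S β)  = suc (height α ⊔ height β)

  infix 4 _≼_
  record _≼_ (φ : PLTL m) (h : ℕ) : Set where
    constructor bounded
    field height≤ : height φ ≤ h

  ≼-weaken : ∀ {φ h h′} → h ≤ h′ → φ ≼ h → φ ≼ h′
  ≼-weaken h≤h′ (bounded p) = bounded (≤-trans p h≤h′)

  ≼-step : ∀ {φ h} → φ ≼ h → φ ≼ suc h
  ≼-step = ≼-weaken (n≤1+n _)

  ≼-var : ∀ {i h} → var i ≼ suc h
  ≼-var = bounded (s≤s z≤n)

  ≼-⊤ : ∀ {h} → ⊤ᶠ ≼ suc h
  ≼-⊤ = bounded (s≤s z≤n)

  ≼-const : ∀ {b h} → const b ≼ suc h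
  ≼-const {true}  = bounded (s≤s z≤n)
  ≼-const {false} = bounded (s≤s z≤n)

  ≼-¬ : ∀ {α h} → α ≼ h → ¬ᶠ α ≼ suc h
  ≼-¬ (bounded p) = bounded (s≤s p)

  ≼-⊖ : ∀ {α h} → α ≼ h → ⊖ α ≼ suc h
  ≼-⊖ (bounded p) = bounded (s≤s p)

  ≼-∧ : ∀ {α β h} → α ≼ h → β ≼ h → α ∧ᶠ β ≼ suc h
  ≼-∧ (bounded p) (bounded q) = bounded (s≤s (⊔-lub p q))

  ≼-∨ : ∀ {α β h} → α ≼ h → β ≼ h → α ∨ᶠ β ≼ suc h
  ≼-∨ (bounded p) (bounded q) = bounded (s≤s (⊔-lub p q))

  ≼-S : ∀ {α β h} → α ≼ h → β ≼ h → α S β ≼ suc h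
  ≼-S (bounded p) (bounded q) = bounded (s≤s (⊔-lub p q))

  size<2^ : ∀ {φ h} → height φ ≤ h → size φ < 2 ^ h
  size<2^ {var _}  {suc h} _       = leaf-bound h
  size<2^ {⊤ᶠ}     {suc h} _       = leaf-bound h
  size<2^ {⊥ᶠ}     {suc h} _       = leaf-bound h
  size<2^ {¬ᶠ α}   {suc h} (s≤s p) = unary-bound h (size<2^ {α} p)
  size<2^ {⊖ α}    {suc h} (s≤s p) = unary-bound h (size<2^ {α} p)
  size<2^ {α ∧ᶠ β} {suc h} (s≤s p) =
    binary-bound h (size<2^ {α} (m⊔n≤o⇒m≤o _ (height β) p)) (size<2^ {β} (m⊔n≤o⇒n≤o (height α) _ p))
  size<2^ {α ∨ᶠ β} {suc h} (s≤s p) =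
    binary-bound h (size<2^ {α} (m⊔n≤o⇒m≤o _ (height β) p)) (size<2^ {β} (m⊔n≤o⇒n≤o (height α) _ p))
  size<2^ {α S β}  {suc h} (s≤s p) =
    binary-bound h (size<2^ {α} (m⊔n≤o⇒m≤o _ (height β) p)) (size<2^ {β} (m⊔n≤o⇒n≤o (height α) _ p))

  ≼-shannon : ∀ {n} (g : Vec Bool n → Bool) {F : Vec (PLTL m) n} {e} →
              All (_≼ suc e) F → shannon g F ≼ suc (n * 3 + e)
  ≼-shannon g [] = ≼-const
  ≼-shannon {suc n} g {φ ∷ _} {e} (p ∷ ps) =
    ≼-∨ (≼-step (≼-∧ p′ (≼-shannon _ ps))) (≼-∧ (≼-¬ p′) (≼-step (≼-shannon _ ps)))
    where
      p′ : φ ≼ suc (n * 3 + e)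
      p′ = ≼-weaken (s≤s (m≤n+m e (n * 3))) p

-- the bound of ≼-shannon for highBeforeᶠ ∷ X, whose entries have height at most 8 + (n * 3 + e)
componentHeight : ℕ → ℕ → ℕ
componentHeight n e = suc n * 3 + (7 + (n * 3 + e))

module _ {m n k} (A : FFAutomaton n k) {X : Vec (PLTL m) n} {e} (X≼ : All (_≼ suc e) X) where
  open FlipFlop A X

  ≼-highAfter : highAfterᶠ ≼ 6 + (n * 3 + e)
  ≼-highAfter =
    ≼-∨ (≼-step (≼-step (≼-S (≼-¬ (≼-shannon _ X≼)) (≼-step (≼-shannon _ X≼)))))
        (≼-∧ ≼-const (≼-¬ (≼-S ≼-⊤ (≼-¬ (≼-shannon _ X≼)))))

  ≼-highBefore : highBeforeᶠ ≼ 8 + (n * 3 + e)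
  ≼-highBefore = ≼-∨ (≼-⊖ ≼-highAfter) (≼-∧ (≼-¬ (≼-⊖ ≼-⊤)) ≼-const)

  ≼-output : All (_≼ suc (componentHeight n e)) outputᶠ
  ≼-output = tabulate⁺ λ j → ≼-shannon (outputBit A j) {highBeforeᶠ ∷ X}
    (≼-highBefore ∷ All.map (≼-weaken (s≤s (≤-trans (m≤n+m e (n * 3)) (m≤n+m _ 7)))) X≼)

chainHeight : ∀ {m K} → Chain m K → ℕ
chainHeight []                = 0
chainHeight {m} (_▷_ {K} c A) = componentHeight (m + K) (chainHeight c)

≼-outputs : ∀ {m K} (c : Chain m K) → All (_≼ suc (chainHeight c)) (outputsᶠ c)
≼-outputs []                = []
≼-outputs {m} (_▷_ {K} c A) =
  ++⁺ (All.map (≼-weaken (s≤s e≤h)) (≼-outputs c))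
      (≼-output A (++⁺ (tabulate⁺ λ _ → ≼-var) (≼-outputs c)))
  where
    e≤h : chainHeight c ≤ componentHeight (m + K) (chainHeight c)
    e≤h = ≤-trans (m≤n+m _ ((m + K) * 3)) (≤-trans (m≤n+m _ 7) (m≤n+m _ (suc (m + K) * 3)))

n<2^n : ∀ n → n < 2 ^ n
n<2^n zero    = s≤s z≤n
n<2^n (suc n) = unary-bound n (n<2^n n)

ffSize-positive : ∀ {n k} (A : FFAutomaton n k) → 0 < ffSize A
ffSize-positive {n} {k} A =
  ≤-trans (m^n>0 2 n) (≤-trans (m≤m+n (2 ^ n) _) (m≤m*n (2 * 2 ^ n) (suc k)))

componentHeight≤ : ∀ {n k} (A : FFAutomaton n k) e → componentHeight n e ≤ e + 8 * ffSize A
componentHeight≤ {n} {k} A e = begin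
  componentHeight n e                   ≤⟨ m≤m+n _ (10 * n + 6) ⟩
  componentHeight n e + (10 * n + 6)    ≡⟨ expand n e ⟩
  e + 16 * suc n                        ≤⟨ +-monoʳ-≤ e (*-monoʳ-≤ 16 (n<2^n n)) ⟩
  e + 16 * 2 ^ n                        ≤⟨ +-monoʳ-≤ e (m≤m*n (16 * 2 ^ n) (suc k)) ⟩
  e + 16 * 2 ^ n * suc k                ≡⟨ regroup (2 ^ n) (suc k) e ⟩
  e + 8 * ffSize A                      ∎
  where
    open ≤-Reasoning
    expand : ∀ n e → suc n * 3 + (7 + (n * 3 + e)) + (10 * n + 6) ≡ e + 16 * suc n
    expand = solve-∀
    regroup : ∀ p s e → e + 16 * p * s ≡ e + 8 * (2 * p * s)
    regroup = solve-∀

chainHeight≤ : ∀ {m K} (c : Chain m K) → chainHeight c ≤ 8 * chainSize c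
chainHeight≤ [] = z≤n
chainHeight≤ {m} (_▷_ {K} c A) = begin
  componentHeight (m + K) (chainHeight c) ≤⟨ componentHeight≤ A (chainHeight c) ⟩
  chainHeight c + 8 * ffSize A            ≤⟨ +-monoˡ-≤ _ (chainHeight≤ c) ⟩
  8 * chainSize c + 8 * ffSize A          ≡⟨ *-distribˡ-+ 8 (chainSize c) (ffSize A) ⟨
  8 * (chainSize c + ffSize A)            ∎
  where open ≤-Reasoning

cascadeSize-positive : ∀ {m} (A : FFCascadeAcceptor m) → 0 < cascadeSize A
cascadeSize-positive A = ≤-trans (ffSize-positive (last A)) (m≤n+m _ (chainSize (front A)))

cascadeFormula-size : ∀ {m} (A : FFCascadeAcceptor m) →
                      size (cascadeFormula A) ≤ 2 ^ (9 * cascadeSize A)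
cascadeFormula-size A = <⇒≤ (size<2^ (begin
  height (cascadeFormula A)  ≤⟨ _≼_.height≤ (lookup⁺ (≼-outputs C) (K A ↑ʳ fzero)) ⟩
  suc (chainHeight C)        ≤⟨ s≤s (chainHeight≤ C) ⟩
  suc (8 * cascadeSize A)    ≤⟨ +-monoˡ-≤ (8 * cascadeSize A) (cascadeSize-positive A) ⟩
  9 * cascadeSize A          ∎))
  where
    C = toChain A
    open ≤-Reasoning

corollary3 : Σ ℕ λ c → ∀ (m : ℕ) (A : FFCascadeAcceptor m) →
    Σ (PLTL m) λ φ → (size φ ≤ 2 ^ (c * cascadeSize A)) ×
      (∀ (σ : Vec Bool m) (w : List (Vec Bool m)) →
        Accepts φ (σ ∷ w) ⇔ Recognises A (σ ∷ w))
corollary3 = 9 , λ m A → cascadeFormula A , cascadeFormula-size A , cascadeFormula-correct A
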